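{- Let $G$ be a mixed unit interval graph and let $\mathcal{B}$ be a $\mathcal{U}$-bubble model for $G$. Then the number of columns of $\mathcal{B}$ is at least $\alpha(G)$ and at most $2\alpha(G)$, where $\alpha(G)$ is the maximum size of an independent set of $G$.
   Context: A mixed unit interval graph is the intersection graph of a family of unit-length intervals each of which may be closed, open, closed-open or open-closed. A 2-dimensional $\mathcal{U}$-bubble structure for a finite nonempty set $A$ is a family $\mathcal{B}=\langle B_{i,j}\rangle_{1\le j\le k,\,1\le i\le r_j}$ of pairwise disjoint (possibly empty) sets ("bubbles") with union $A$, where each bubble is partitioned into four (possibly empty) quadrants $B_{i,j}=B^{++}_{i,j}\cup B^{+- }_{i,j}\cup B^{ -+}_{i,j}\cup B^{ -- }_{i,j}$. Write $B^{*+}_{i,j}=B^{++}_{i,j}\cup B^{ -+}_{i,j}$ and $B^{+*}_{i,j}=B^{++}_{i,j}\cup B^{+- }_{i,j}$. Bubbles with the same $j$ form column $j$ (so there are $k$ columns); bubbles with the same $i$ form row $i$. The graph $G(\mathcal{B})$ has vertex set $A$, and distinct $u,v$ are adjacent iff, for some ordering of $u,v$, $u\in B_{i,j}$, $v\in B_{i',j'}$ and one of: (a) $j=j'$; (b) $j=j'-1$ and $i>i'$; (c) $j=j'-1$, $i=i'$, $u\in B^{*+}_{i,j}$ and $v\in B^{+*}_{i',j'}$. A $\mathcal{U}$-bubble model of $G$ is such a structure for $V(G)$ with (i) $G\cong G(\mathcal{B})$; (ii) each column and each row contains a nonempty bubble; (iii) $B_{r_j,j}\neq\emptyset$ for every $j$;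 (iv) with $\mathrm{top}(j)=\min\{i:B_{i,j}\neq\emptyset\}$, $\mathrm{top}(1)=1$ and $\mathrm{top}(j)\le\mathrm{top}(j+1)$.
   Formalization: The unit intervals whose intersection graph is G have rational endpoints. -}

module Defs where

open import Data.Nat using (ℕ; zero; suc; _≤_; _<_)
open import Data.Fin using (Fin; toℕ)
open import Data.Bool using (Bool; true; false)
open import Data.Product using (Σ; ∃; ∃-syntax; _×_; _,_; proj₁; proj₂)
open import Data.Sum using (_⊎_)
open import Data.List using (List; length)
open import Data.List.Membership.Propositional using (_∈_)
open import Data.List.Relation.Unary.Unique.Propositional using (Unique)
open import Data.Rational using (ℚ; 1ℚ) renaming (_+_ to _+q_; _<_ to _<q_)
open import Relation.Nullary using (¬_)
open import Relation.Binary.PropositionalEquality using (_≡_)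
open import Function.Bundles using (_⇔_)
open import Function.Definitions using (Bijective)

record Graph : Set₁ where
  field
    n      : ℕ
    Adj    : Fin n → Fin n → Set
    sym    : ∀ {u v} → Adj u v → Adj v u
    irrefl : ∀ {u} → ¬ Adj u u
open Graph public

IsIndependent : (G : Graph) → List (Fin (n G)) → Set
IsIndependent G S = Unique S × (∀ {u v} → u ∈ S → v ∈ S → ¬ Adj G u v)

IsIndependenceNumber : Graph → ℕ → Set
IsIndependenceNumber G a =
  (∃[ S ] (IsIndependent G S × length S ≡ a)) ×
  (∀ S → IsIndependent G S → length S ≤ a)

-- Mixed unit interval graphs.
-- A unit interval with left endpoint l and right endpoint l+1, each
-- endpoint independently closed (true) or open (false).

record MixedUnitInterval : Set where
  field
    left        : ℚ
    leftClosed  : Bool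
    rightClosed : Bool
open MixedUnitInterval public

_∈I_ : ℚ → MixedUnitInterval → Set
x ∈I I =
  (left I <q x ⊎ (leftClosed I ≡ true × left I ≡ x)) ×
  (x <q (left I +q 1ℚ) ⊎ (rightClosed I ≡ true × x ≡ left I +q 1ℚ))

Intersect : MixedUnitInterval → MixedUnitInterval → Set
Intersect I J = ∃[ x ] (x ∈I I × x ∈I J)

IsMixedUnitIntervalGraph : Graph → Set
IsMixedUnitIntervalGraph G =
  Σ (Fin (n G) → MixedUnitInterval) λ I →
    ∀ u v → ¬ u ≡ v → (Adj G u v ⇔ Intersect (I u) (I v))

-- Indices are 0-based: column j ∈ Fin k stands for column j+1, row
-- i ∈ Fin (r j) stands for row i+1.  Each vertex is assigned its bubble
-- (column, row) and quadrant (s₁, s₂), where s = true means '+'.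
-- Bubbles are the fibres of this assignment, hence pairwise disjoint
-- with union Fin m, and possibly empty.

record BubbleStructure (m : ℕ) : Set where
  field
    nonempty : 0 < m
    k        : ℕ
    r        : Fin k → ℕ
    col      : Fin m → Fin k
    row      : (v : Fin m) → Fin (r (col v))
    sign₁    : Fin m → Bool
    sign₂    : Fin m → Bool
open BubbleStructure public

rowℕ : ∀ {m} (B : BubbleStructure m) → Fin m → ℕ
rowℕ B v = toℕ (row B v)

BubbleRel : ∀ {m} → BubbleStructure m → Fin m → Fin m → Set
BubbleRel B u v =
  (col B u ≡ col B v) ⊎
  ((suc (toℕ (col B u)) ≡ toℕ (col B v)) × rowℕ B v < rowℕ B u) ⊎
  ((suc (toℕ (col B u)) ≡ toℕ (col B v)) × rowℕ B u ≡ rowℕ B v ×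
     sign₂ B u ≡ true × sign₁ B v ≡ true)

BubbleAdj : ∀ {m} → BubbleStructure m → Fin m → Fin m → Set
BubbleAdj B u v = ¬ u ≡ v × (BubbleRel B u v ⊎ BubbleRel B v u)

IsTop : ∀ {m} (B : BubbleStructure m) → Fin (k B) → ℕ → Set
IsTop B j t =
  (∃[ v ] (col B v ≡ j × rowℕ B v ≡ t)) ×
  (∀ v → col B v ≡ j → t ≤ rowℕ B v)

record Iso (G : Graph) (B : BubbleStructure (n G)) : Set where
  field
    f       : Fin (n G) → Fin (n G)
    bij     : Bijective _≡_ _≡_ f
    adj-iff : ∀ u v → Adj G u v ⇔ BubbleAdj B (f u) (f v)

record BubbleModel (G : Graph) : Set where
  field
    B         : BubbleStructure (n G)
    iso       : Iso G B
    colNonempty : ∀ (j : Fin (k B)) → ∃[ v ] (col B v ≡ j)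
    -- (ii) every row contains a nonempty bubble (row i exists iff i < r j for some j)
    rowNonempty : ∀ (j : Fin (k B)) (i : Fin (r B j)) → ∃[ v ] (rowℕ B v ≡ toℕ i)
    lastNonempty : ∀ (j : Fin (k B)) → ∃[ v ] (col B v ≡ j × suc (rowℕ B v) ≡ r B j)
    topFirst  : ∀ (j : Fin (k B)) → toℕ j ≡ 0 → IsTop B j 0
    topMono   : ∀ (j j' : Fin (k B)) → suc (toℕ j) ≡ toℕ j' →
                ∀ t t' → IsTop B j t → IsTop B j' t' → t ≤ t'

columns : ∀ {G} → BubbleModel G → ℕ
columns M = k (BubbleModel.B M)

{-# OPTIONS --safe #-}
-- Every column of a bubble model is a clique, so an independent set meets each
-- column at most once and α ≤ k.  Vertices whose columns are two or more apart
-- are never adjacent, so one vertex from every other column, starting with the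
-- first, is an independent set of size ⌈k/2⌉, whence k ≤ 2⌈k/2⌉ ≤ 2α.
module Submission where

open import Defs hiding (sym)
open import Data.Nat using (ℕ; zero; suc; _+_; _*_; _≤_; _<_; z<s; s<s; ⌊_/2⌋; ⌈_/2⌉)
open import Data.Nat.Properties
  using (≤-trans; +-monoˡ-≤; *-monoʳ-≤; *-suc; *-cancelˡ-≡; +-identityʳ; even≢odd;
         ⌊n/2⌋≤⌈n/2⌉; ⌊n/2⌋+⌈n/2⌉≡n; module ≤-Reasoning)
open import Data.Fin as Fin using (Fin; toℕ; fromℕ<; _≟_)
open import Data.Fin.Properties using (toℕ-injective; toℕ-fromℕ<; toℕ<n; injective⇒≤)
open import Data.Product using (_×_; _,_; proj₁; proj₂)
open import Data.Sum using (_⊎_; inj₁; inj₂)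
open import Data.List using (List; _∷_; length; lookup; tabulate)
open import Data.List.Properties using (length-tabulate)
open import Data.List.Relation.Unary.All as All using ()
open import Data.List.Relation.Unary.AllPairs using (_∷_)
open import Data.List.Relation.Unary.Unique.Propositional using (Unique)
open import Data.List.Relation.Unary.Unique.Propositional.Properties using (tabulate⁺)
open import Data.List.Membership.Propositional using (_∈_)
open import Data.List.Membership.Propositional.Properties using (∈-lookup; ∈-tabulate⁻)
open import Function using (_∘_)
open import Function.Bundles using (module Equivalence)
open import Function.Definitions using (Injective)
open import Relation.Nullary using (¬_; yes; no; contradiction)
open import Relation.Binary.PropositionalEquality
  using (_≡_; _≢_; refl; sym; trans; cong; subst; subst₂; module ≡-Reasoning)

lookup-injective : ∀ {A : Set} {xs : List A} → Unique xs → Injective _≡_ _≡_ (lookup xs)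
lookup-injective (_  ∷ _)  {Fin.zero}  {Fin.zero}  _  = refl
lookup-injective (x∉ ∷ _)  {Fin.zero}  {Fin.suc j} eq = contradiction eq (All.lookup x∉ (∈-lookup j))
lookup-injective (x∉ ∷ _)  {Fin.suc i} {Fin.zero}  eq = contradiction (sym eq) (All.lookup x∉ (∈-lookup i))
lookup-injective (_  ∷ xs) {Fin.suc i} {Fin.suc j} eq = cong Fin.suc (lookup-injective xs eq)

IsCliqueCover : ∀ (G : Graph) {k} → (Fin (n G) → Fin k) → Set
IsCliqueCover G c = ∀ {u v} → u ≢ v → c u ≡ c v → Adj G u v

module _ (G : Graph) where

  independent⇒length≤ : ∀ {k} {c : Fin (n G) → Fin k} → IsCliqueCover G c →
                         ∀ {S} → IsIndependent G S → length S ≤ k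
  independent⇒length≤ {c = c} cover {S} (S-unique , S-indep) = injective⇒≤ c∘S-injective
    where
    c∘S-injective : Injective _≡_ _≡_ (c ∘ lookup S)
    c∘S-injective {i} {j} eq with lookup S i ≟ lookup S j
    ... | yes Si≡Sj = lookup-injective S-unique Si≡Sj
    ... | no  Si≢Sj = contradiction (cover Si≢Sj eq) (S-indep (∈-lookup i) (∈-lookup j))

  tabulate-independent : ∀ {c} {h : Fin c → Fin (n G)} → Injective _≡_ _≡_ h →
                         (∀ x y → ¬ Adj G (h x) (h y)) → IsIndependent G (tabulate h)
  tabulate-independent {h = h} h-injective nonadjacent = tabulate⁺ h-injective , independent
    where
    independent : ∀ {u v} → u ∈ tabulate h → v ∈ tabulate h → ¬ Adj G u v
    independent u∈ v∈ with ∈-tabulate⁻ u∈ | ∈-tabulate⁻ v∈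
    ... | x , refl | y , refl = nonadjacent x y

<⌈n/2⌉⇒2*m<n : ∀ {m} n → m < ⌈ n /2⌉ → 2 * m < n
<⌈n/2⌉⇒2*m<n {zero}  (suc n)       _        = z<s
<⌈n/2⌉⇒2*m<n {suc m} (suc (suc n)) (s<s m<) =
  subst (_< suc (suc n)) (sym (*-suc 2 m)) (s<s (s<s (<⌈n/2⌉⇒2*m<n n m<)))

n≤2*⌈n/2⌉ : ∀ n → n ≤ 2 * ⌈ n /2⌉
n≤2*⌈n/2⌉ n = begin
  n                       ≡⟨ sym (⌊n/2⌋+⌈n/2⌉≡n n) ⟩
  ⌊ n /2⌋ + ⌈ n /2⌉       ≤⟨ +-monoˡ-≤ ⌈ n /2⌉ (⌊n/2⌋≤⌈n/2⌉ n) ⟩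
  ⌈ n /2⌉ + ⌈ n /2⌉       ≡⟨ cong (⌈ n /2⌉ +_) (sym (+-identityʳ ⌈ n /2⌉)) ⟩
  2 * ⌈ n /2⌉             ∎
  where open ≤-Reasoning

AtMostOneApart : ℕ → ℕ → Set
AtMostOneApart m n = m ≡ n ⊎ suc m ≡ n ⊎ suc n ≡ m

AtMostOneApart-sym : ∀ {m n} → AtMostOneApart m n → AtMostOneApart n m
AtMostOneApart-sym (inj₁ m≡n)          = inj₁ (sym m≡n)
AtMostOneApart-sym (inj₂ (inj₁ 1+m≡n)) = inj₂ (inj₂ 1+m≡n)
AtMostOneApart-sym (inj₂ (inj₂ 1+n≡m)) = inj₂ (inj₁ 1+n≡m)

evens-atMostOneApart⇒≡ : ∀ {m n} → AtMostOneApart (2 * m) (2 * n) → m ≡ n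
evens-atMostOneApart⇒≡ {m} {n} (inj₁ eq)        = *-cancelˡ-≡ m n 2 eq
evens-atMostOneApart⇒≡ {m} {n} (inj₂ (inj₁ eq)) = contradiction (sym eq) (even≢odd n m)
evens-atMostOneApart⇒≡ {m} {n} (inj₂ (inj₂ eq)) = contradiction (sym eq) (even≢odd m n)

module _ {m} (B : BubbleStructure m) where

  sameColumn⇒BubbleAdj : ∀ {u v} → u ≢ v → col B u ≡ col B v → BubbleAdj B u v
  sameColumn⇒BubbleAdj u≢v same = u≢v , inj₁ (inj₁ same)

  BubbleRel⇒atMostOneApart : ∀ {u v} → BubbleRel B u v →
                             AtMostOneApart (toℕ (col B u)) (toℕ (col B v))
  BubbleRel⇒atMostOneApart (inj₁ same)              = inj₁ (cong toℕ same)
  BubbleRel⇒atMostOneApart (inj₂ (inj₁ (next , _))) = inj₂ (inj₁ next)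
  BubbleRel⇒atMostOneApart (inj₂ (inj₂ (next , _))) = inj₂ (inj₁ next)

  BubbleAdj⇒atMostOneApart : ∀ {u v} → BubbleAdj B u v →
                             AtMostOneApart (toℕ (col B u)) (toℕ (col B v))
  BubbleAdj⇒atMostOneApart (_ , inj₁ uv) = BubbleRel⇒atMostOneApart uv
  BubbleAdj⇒atMostOneApart (_ , inj₂ vu) = AtMostOneApart-sym (BubbleRel⇒atMostOneApart vu)

module BubbleModelColumns {G : Graph} (M : BubbleModel G) where
  open BubbleModel M
  open Iso iso
  open Equivalence

  column : Fin (n G) → Fin (columns M)
  column = col B ∘ f

  column-isCliqueCover : IsCliqueCover G column
  column-isCliqueCover {u} {v} u≢v same =
    from (adj-iff u v) (sameColumn⇒BubbleAdj B (u≢v ∘ proj₁ bij) same)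

  Adj⇒atMostOneApart : ∀ {u v} → Adj G u v → AtMostOneApart (toℕ (column u)) (toℕ (column v))
  Adj⇒atMostOneApart {u} {v} uv = BubbleAdj⇒atMostOneApart B (to (adj-iff u v) uv)

  vertexIn : Fin (columns M) → Fin (n G)
  vertexIn j = proj₁ (proj₂ bij (proj₁ (colNonempty j)))

  column-vertexIn : ∀ j → column (vertexIn j) ≡ j
  column-vertexIn j = trans (cong (col B) (proj₂ (proj₂ bij w) refl)) (proj₂ (colNonempty j))
    where w = proj₁ (colNonempty j)

  evenColumnVertex : Fin ⌈ columns M /2⌉ → Fin (n G)
  evenColumnVertex x = vertexIn (fromℕ< (<⌈n/2⌉⇒2*m<n (columns M) (toℕ<n x)))

  toℕ-column-evenColumnVertex : ∀ x → toℕ (column (evenColumnVertex x)) ≡ 2 * toℕ x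
  toℕ-column-evenColumnVertex x = trans (cong toℕ (column-vertexIn _)) (toℕ-fromℕ< _)

  evenColumnVertex-injective : Injective _≡_ _≡_ evenColumnVertex
  evenColumnVertex-injective {x} {y} eq = toℕ-injective (*-cancelˡ-≡ (toℕ x) (toℕ y) 2 (begin
    2 * toℕ x                              ≡⟨ sym (toℕ-column-evenColumnVertex x) ⟩
    toℕ (column (evenColumnVertex x))      ≡⟨ cong (toℕ ∘ column) eq ⟩
    toℕ (column (evenColumnVertex y))      ≡⟨ toℕ-column-evenColumnVertex y ⟩
    2 * toℕ y                              ∎))
    where open ≡-Reasoning

  evenColumnVertex-nonadjacent : ∀ x y → ¬ Adj G (evenColumnVertex x) (evenColumnVertex y)
  evenColumnVertex-nonadjacent x y xy = irrefl G (subst (Adj G _ ∘ evenColumnVertex) (sym x≡y) xy)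
    where
    x≡y : x ≡ y
    x≡y = toℕ-injective (evens-atMostOneApart⇒≡ (subst₂ AtMostOneApart
      (toℕ-column-evenColumnVertex x) (toℕ-column-evenColumnVertex y) (Adj⇒atMostOneApart xy)))

lemma15 : (G : Graph) → IsMixedUnitIntervalGraph G → (M : BubbleModel G) →
            (α : ℕ) → IsIndependenceNumber G α →
            α ≤ columns M × columns M ≤ 2 * α
lemma15 G _ M α ((S , S-independent , |S|≡α) , maximal) = α≤k , k≤2α
  where
  open BubbleModelColumns M

  α≤k : α ≤ columns M
  α≤k = subst (_≤ columns M) |S|≡α (independent⇒length≤ G column-isCliqueCover S-independent)

  ⌈k/2⌉≤α : ⌈ columns M /2⌉ ≤ α
  ⌈k/2⌉≤α = subst (_≤ α) (length-tabulate evenColumnVertex)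
    (maximal _ (tabulate-independent G evenColumnVertex-injective evenColumnVertex-nonadjacent))

  k≤2α : columns M ≤ 2 * α
  k≤2α = ≤-trans (n≤2*⌈n/2⌉ (columns M)) (*-monoʳ-≤ 2 ⌈k/2⌉≤α)
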